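{- Let $\mathcal F$ be the singleton family consisting of the trivial danger of size 2. Let $G$ be a graph on at least two vertices, viewed as a 2-uniform marked hypergraph with no marked vertex. Then $G$ is a Breaker win if and only if $J_1(\mathcal F,G)$ holds.
   Context: A marked hypergraph $H$: finite nonempty $V(H)$, edge set $E(H)$ of nonempty subsets of $V(H)$, marked set $M(H)\subseteq V(H)$. Subhypergraph $X$: $V(X)\subseteq V(H)$, $E(X)\subseteq E(H)$, $M(X)=V(X)\cap M(H)$. $H^{+x}$ marks non-marked $x$; $H^{ -y}$ deletes $y$ and all edges containing it. Trivial Maker win: some edge $e$ with $|e\setminus M(H)|\le1$. Maker win (recursive): if $|V(H)\setminus M(H)|\le1$, iff trivial Maker win; otherwise iff some non-marked $x$ has $H^{+x-y}$ a Maker win for all non-marked $y\ne x$; otherwise Breaker win. A pointed marked hypergraph is $(D,x)$ with $x\in V(D)\setminus M(D)$; isomorphism preserves edges, marks and point. The trivial danger of size 2 is $(D,x)$ where $D$ consists of a single edge $\{x,u\}$ with $x\ne u$ and no marked vertices. $x\mathcal F(H)$: subhypergraphs $X\ni x$ of $H$ with $(X,x)$ isomorphic to a member of $\mathcal F$. $\mathrm{Int}_H(\mathcal X)$: non-marked vertices of $H$ lying in every member of $\mathcal X$. $J_1(\mathcal F,H)$: for every $x\in V(H)\setminus M(H)$, $\mathrm{Int}_{H^{+x}}(x\mathcal F(H))\ne\varnothing$. -}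

module Defs where

open import Data.Nat using (ℕ)
open import Data.Bool using (Bool; _∧_)
open import Data.Fin using (Fin; zero; suc)
open import Data.Fin.Subset using (Subset; _∈_; _∉_; _⊆_; ⊤; ⊥; ⁅_⁆; _∪_; _∩_; _─_; ∁; Nonempty)
open import Data.Vec using (lookup; tabulate)
open import Data.Product using (Σ; ∃; ∃₂; _×_; _,_)
open import Relation.Binary.PropositionalEquality using (_≡_; _≢_)
open import Relation.Nullary using (¬_)
open import Relation.Binary using (Decidable)
open import Function.Bundles using (_⇔_)
open import Data.Unit using () renaming (⊤ to Unit)

record MHG (n : ℕ) : Set₁ where
  field
    V : Subset n
    E : Subset n → Set
    M : Subset n
open MHG public

record IsMHG {n : ℕ} (H : MHG n) : Set where
  field
    V-nonempty : Nonempty (V H)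
    edge-nonempty : ∀ e → E H e → Nonempty e
    edge-⊆V : ∀ e → E H e → e ⊆ V H
    M-⊆V : M H ⊆ V H

Free : ∀ {n} → MHG n → Subset n
Free H = V H ─ M H

AtMostOne : ∀ {n} → Subset n → Set
AtMostOne S = ∀ a b → a ∈ S → b ∈ S → a ≡ b

mark : ∀ {n} → MHG n → Fin n → MHG n
mark H x = record { V = V H ; E = E H ; M = M H ∪ ⁅ x ⁆ }

delete : ∀ {n} → MHG n → Fin n → MHG n
delete H y = record
  { V = V H ─ ⁅ y ⁆
  ; E = λ e → E H e × y ∉ e
  ; M = M H ─ ⁅ y ⁆ }

TrivialMakerWin : ∀ {n} → MHG n → Set
TrivialMakerWin H = ∃ λ e → E H e × AtMostOne (e ─ M H)

data MakerWin {n : ℕ} : MHG n → Set₁ where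
  base : ∀ {H} → AtMostOne (Free H) → TrivialMakerWin H → MakerWin H
  step : ∀ {H} → ¬ AtMostOne (Free H) →
         (x : Fin n) → x ∈ Free H →
         (∀ y → y ∈ Free H → y ≢ x → MakerWin (delete (mark H x) y)) →
         MakerWin H

BreakerWin : ∀ {n} → MHG n → Set₁
BreakerWin H = ¬ MakerWin H

record IsSub {n : ℕ} (X H : MHG n) : Set where
  field
    isMHG : IsMHG X
    V⊆ : V X ⊆ V H
    E⊆ : ∀ e → E X e → E H e
    M≡ : M X ≡ V X ∩ M H

record Pointed (n : ℕ) : Set₁ where
  constructor _,ₚ_
  field
    graph : MHG n
    pt : Fin n

-- image of e ⊆ Fin n under a bijection V(A) ≅ V(B) given by g : Fin m → Fin n
-- (the inverse map): j ∈ image iff j ∈ V(B) and g j ∈ e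
imageVia : ∀ {n m} → Subset m → (Fin m → Fin n) → Subset n → Subset m
imageVia W g e = tabulate (λ j → lookup W j ∧ lookup e (g j))

record Iso {n m : ℕ} (A : Pointed n) (B : Pointed m) : Set where
  open Pointed
  field
    f : Fin n → Fin m
    g : Fin m → Fin n
    f-V : ∀ i → i ∈ V (graph A) → f i ∈ V (graph B)
    g-V : ∀ j → j ∈ V (graph B) → g j ∈ V (graph A)
    gf : ∀ i → i ∈ V (graph A) → g (f i) ≡ i
    fg : ∀ j → j ∈ V (graph B) → f (g j) ≡ j
    f-E : ∀ e → E (graph A) e → E (graph B) (imageVia (V (graph B)) g e)
    g-E : ∀ e → E (graph B) e → E (graph A) (imageVia (V (graph A)) f e)
    f-M : ∀ i → i ∈ V (graph A) → (i ∈ M (graph A) ⇔ f i ∈ M (graph B))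
    f-pt : f (pt A) ≡ pt B

record Family : Set₁ where
  field
    Idx : Set
    size : Idx → ℕ
    member : (i : Idx) → Pointed (size i)
open Family public

_·_⟨_⟩ : ∀ {n} → Fin n → Family → MHG n → MHG n → Set
(x · 𝓕 ⟨ H ⟩) X = IsSub X H × x ∈ V X × ∃ λ i → Iso (X ,ₚ x) (member 𝓕 i)

Int : ∀ {n} → MHG n → (MHG n → Set) → Fin n → Set₁
Int H 𝓧 v = v ∈ V H × v ∉ M H × (∀ X → 𝓧 X → v ∈ V X)

J₁ : ∀ {n} → Family → MHG n → Set₁
J₁ 𝓕 H = ∀ x → x ∈ V H → x ∉ M H → ∃ λ v → Int (mark H x) (x · 𝓕 ⟨ H ⟩) v

trivialDanger2 : Pointed 2
trivialDanger2 = record { V = ⊤ ; E = λ e → e ≡ ⊤ ; M = ⊥ } ,ₚ zero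

𝓕₂ : Family
𝓕₂ = record { Idx = Unit ; size = λ _ → 2 ; member = λ _ → trivialDanger2 }

record Graph (n : ℕ) : Set₁ where
  field
    Adj : Fin n → Fin n → Set
    adj? : Decidable Adj
    sym : ∀ {i j} → Adj i j → Adj j i
    irrefl : ∀ {i} → ¬ Adj i i
open Graph public

toMHG : ∀ {n} → Graph n → MHG n
toMHG G = record
  { V = ⊤
  ; E = λ e → ∃₂ λ i j → Adj G i j × e ≡ ⁅ i ⁆ ∪ ⁅ j ⁆
  ; M = ⊥ }

-- Both conditions say that G is a matching (every vertex has degree at most 1).
-- If some x has two neighbours u ≠ w, Maker marks x; whichever vertex Breaker
-- deletes, one of the edges {x,u}, {x,w} survives with a single free vertex,
-- and a hypergraph with such an edge is a Maker win. If G is a matching,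
-- Breaker answers each move by deleting the partner of Maker's vertex, which
-- keeps every surviving edge entirely free, so no trivial Maker win ever
-- appears. On the J₁ side, the members of x𝓕₂(G) are exactly the edges at x,
-- so their common non-marked vertices other than x form a nonempty set iff
-- x has at most one neighbour (for degree 0 the family is empty and 2 ≤ n
-- supplies a vertex).
module Submission where

open import Defs
open import Data.Nat using (ℕ; _≤_; _<_; s≤s)
open import Data.Nat.Induction using (<-wellFounded)
open import Induction.WellFounded using (Acc; acc)
open import Data.Bool using (true; _∧_)
open import Data.Bool.Properties using (∧-identityʳ)
open import Data.Fin using (Fin; zero; suc; _≟_)
open import Data.Fin.Properties using (any?)
open import Data.Fin.Subset
  using (Subset; _∈_; _∉_; _⊆_; _⊂_; ⊤; ⊥; ⁅_⁆; _∪_; _─_; ∣_∣)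
open import Data.Fin.Subset.Properties
  using (_∈?_; ∉⊥; ∈⊤; x∈⁅x⁆; x∈⁅y⁆⇒x≡y; x∈p∪q⁺; x∈p∪q⁻; p⊆p∪q; q⊆p∪q;
         x∈p∧x∉q⇒x∈p─q; p─q⊆p; p⊂q⇒∣p∣<∣q∣; ∩-zeroʳ)
open import Data.Vec using (lookup; tabulate)
open import Data.Vec.Properties
  using ([]=⇒lookup; tabulate∘lookup; tabulate-cong; lookup-replicate)
open import Data.Vec.Base using (_∷_; here; there)
open import Data.Product using (∃; ∃₂; _×_; _,_; proj₁; proj₂)
open import Data.Sum using (_⊎_; inj₁; inj₂; [_,_]′)
open import Data.Empty using (⊥-elim)
open import Data.Unit using (tt)
open import Function.Base using (_∘_)
open import Function.Bundles using (_⇔_; mk⇔)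
open import Function.Construct.Composition using (_⇔-∘_)
open import Function.Construct.Symmetry using (⇔-sym)
open import Relation.Binary.PropositionalEquality as ≡
  using (_≡_; _≢_; refl; trans; cong; cong₂; subst)
open import Relation.Nullary using (¬_; yes; no)
open import Relation.Nullary.Decidable using (_×-dec_; ¬?)

x∈p─q⇒x∉q : ∀ {n} {x : Fin n} (p q : Subset n) → x ∈ p ─ q → x ∉ q
x∈p─q⇒x∉q (_ ∷ p) (true ∷ q) () here
x∈p─q⇒x∉q (_ ∷ p) (_ ∷ q) (there x∈p─q) (there x∈q) = x∈p─q⇒x∉q p q x∈p─q x∈q

x∈⁅y⁆∪⁅z⁆⁻ : ∀ {n} {x y z : Fin n} → x ∈ ⁅ y ⁆ ∪ ⁅ z ⁆ → x ≡ y ⊎ x ≡ z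
x∈⁅y⁆∪⁅z⁆⁻ {y = y} {z} x∈ with x∈p∪q⁻ ⁅ y ⁆ ⁅ z ⁆ x∈
... | inj₁ x∈⁅y⁆ = inj₁ (x∈⁅y⁆⇒x≡y y x∈⁅y⁆)
... | inj₂ x∈⁅z⁆ = inj₂ (x∈⁅y⁆⇒x≡y z x∈⁅z⁆)

x∈⁅x⁆∪⁅y⁆ : ∀ {n} (x y : Fin n) → x ∈ ⁅ x ⁆ ∪ ⁅ y ⁆
x∈⁅x⁆∪⁅y⁆ x y = p⊆p∪q ⁅ y ⁆ (x∈⁅x⁆ x)

y∈⁅x⁆∪⁅y⁆ : ∀ {n} (x y : Fin n) → y ∈ ⁅ x ⁆ ∪ ⁅ y ⁆
y∈⁅x⁆∪⁅y⁆ x y = q⊆p∪q ⁅ x ⁆ ⁅ y ⁆ (x∈⁅x⁆ y)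

atMostOne⊎∃≢ : ∀ {n} (S : Subset n) →
               AtMostOne S ⊎ ∃₂ λ a b → a ∈ S × b ∈ S × a ≢ b
atMostOne⊎∃≢ S with any? (_∈? S)
... | no ∄a = inj₁ λ a _ a∈S _ → ⊥-elim (∄a (a , a∈S))
... | yes (a , a∈S) with any? (λ b → (b ∈? S) ×-dec ¬? (a ≟ b))
...   | yes (b , b∈S , a≢b) = inj₂ (a , b , a∈S , b∈S , a≢b)
...   | no ∄b = inj₁ λ b c b∈S c∈S → trans (≡.sym (a≡ b∈S)) (a≡ c∈S)
  where
  a≡ : ∀ {b} → b ∈ S → a ≡ b
  a≡ {b} b∈S with a ≟ b
  ... | yes a≡b = a≡b
  ... | no a≢b = ⊥-elim (∄b (b , b∈S , a≢b))

¬atMostOne⇒∃≢ : ∀ {n} (S : Subset n) → ¬ AtMostOne S →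
                (x : Fin n) → ∃ λ y → y ∈ S × y ≢ x
¬atMostOne⇒∃≢ S ¬≤1 x with atMostOne⊎∃≢ S
... | inj₁ ≤1 = ⊥-elim (¬≤1 ≤1)
... | inj₂ (a , b , a∈S , b∈S , a≢b) with a ≟ x
...   | no a≢x = a , a∈S , a≢x
...   | yes refl = b , b∈S , a≢b ∘ ≡.sym

∃≢ : ∀ {n} → 2 ≤ n → (x : Fin n) → ∃ λ v → v ≢ x
∃≢ (s≤s (s≤s _)) zero = suc zero , λ ()
∃≢ (s≤s (s≤s _)) (suc x) = zero , λ ()

module _ {n} (H : MHG n) where

  free⇒unmarked : ∀ {i} → i ∈ Free H → i ∉ M H
  free⇒unmarked = x∈p─q⇒x∉q (V H) (M H)

  Free-mark-delete⁺ : ∀ {i x y} → i ∈ Free H → i ≢ x → i ≢ y →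
                      i ∈ Free (delete (mark H x) y)
  Free-mark-delete⁺ {i} {x} {y} i∈F i≢x i≢y =
    x∈p∧x∉q⇒x∈p─q (x∈p∧x∉q⇒x∈p─q (p─q⊆p _ _ i∈F) (i≢y ∘ x∈⁅y⁆⇒x≡y y))
      λ i∈M′ → [ free⇒unmarked i∈F , i≢x ∘ x∈⁅y⁆⇒x≡y x ]′
                 (x∈p∪q⁻ (M H) ⁅ x ⁆ (p─q⊆p _ _ i∈M′))

  Free-mark-delete⁻ : ∀ {i x y} → i ∈ Free (delete (mark H x) y) →
                      i ∈ Free H × i ≢ x
  Free-mark-delete⁻ {i} {x} {y} i∈F′ =
    x∈p∧x∉q⇒x∈p─q (p─q⊆p _ _ i∈V′) (i∉M′ ∘ p⊆p∪q ⁅ x ⁆) ,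
    λ { refl → i∉M′ (x∈p∪q⁺ (inj₂ (x∈⁅x⁆ x))) }
    where
    i∈V′ : i ∈ V H ─ ⁅ y ⁆
    i∈V′ = p─q⊆p _ _ i∈F′
    i∉M′ : i ∉ M H ∪ ⁅ x ⁆
    i∉M′ i∈M = x∈p─q⇒x∉q _ _ i∈F′ (x∈p∧x∉q⇒x∈p─q i∈M (x∈p─q⇒x∉q _ _ i∈V′))

  Free-mark-delete⊂ : ∀ {x y} → x ∈ Free H → Free (delete (mark H x) y) ⊂ Free H
  Free-mark-delete⊂ {x} x∈F =
    proj₁ ∘ Free-mark-delete⁻ , x , x∈F , λ x∈F′ → proj₂ (Free-mark-delete⁻ x∈F′) refl

  x∈M-mark-delete : ∀ {x y} → y ≢ x → x ∈ M (delete (mark H x) y)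
  x∈M-mark-delete {x} {y} y≢x =
    x∈p∧x∉q⇒x∈p─q (x∈p∪q⁺ (inj₂ (x∈⁅x⁆ x))) (y≢x ∘ ≡.sym ∘ x∈⁅y⁆⇒x≡y y)

  edge-mark-delete : ∀ {x y e} → E H e → e ⊆ M H ∪ ⁅ x ⁆ → y ∈ Free H → y ≢ x →
                     E (delete (mark H x) y) e × e ⊆ M (delete (mark H x) y)
  edge-mark-delete {x} {y} {e} e∈E e⊆ y∈F y≢x =
    (e∈E , y∉e) , λ i∈e → x∈p∧x∉q⇒x∈p─q (e⊆ i∈e) λ i∈⁅y⁆ →
      y∉e (subst (_∈ e) (x∈⁅y⁆⇒x≡y y i∈⁅y⁆) i∈e)
    where
    y∉e : y ∉ e
    y∉e y∈e = [ free⇒unmarked y∈F , y≢x ∘ x∈⁅y⁆⇒x≡y x ]′ (x∈p∪q⁻ (M H) ⁅ x ⁆ (e⊆ y∈e))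

MarkedEdge : ∀ {n} → MHG n → Set
MarkedEdge H = ∃ λ e → E H e × e ⊆ M H

markedEdge⇒makerWin : ∀ {n} (H : MHG n) → MarkedEdge H → MakerWin H
markedEdge⇒makerWin H = go H (<-wellFounded _)
  where
  go : ∀ H → Acc _<_ (∣ Free H ∣) → MarkedEdge H → MakerWin H
  go H (acc rec) (e , e∈E , e⊆M) with atMostOne⊎∃≢ (Free H)
  ... | inj₁ ≤1 = base ≤1 (e , e∈E , λ a _ a∈ _ →
                    ⊥-elim (x∈p─q⇒x∉q e (M H) a∈ (e⊆M (p─q⊆p _ _ a∈))))
  ... | inj₂ (a , b , a∈F , b∈F , a≢b) =
    step (λ ≤1 → a≢b (≤1 a b a∈F b∈F)) a a∈F λ y y∈F y≢a →
      go _ (rec (p⊂q⇒∣p∣<∣q∣ (Free-mark-delete⊂ H a∈F)))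
        (e , edge-mark-delete H e∈E (p⊆p∪q ⁅ a ⁆ ∘ e⊆M) y∈F y≢a)

-- Maker marks z; Breaker cannot touch e, which is then fully marked.
nearlyMarkedEdge⇒makerWin : ∀ {n} (H : MHG n) {z e} → z ∈ Free H →
                            E H e → e ⊆ M H ∪ ⁅ z ⁆ → MakerWin H
nearlyMarkedEdge⇒makerWin H {z} {e} z∈F e∈E e⊆ with atMostOne⊎∃≢ (Free H)
... | inj₁ ≤1 = base ≤1 (e , e∈E , λ a b a∈ b∈ → trans (≡z a∈) (≡.sym (≡z b∈)))
  where
  ≡z : ∀ {a} → a ∈ e ─ M H → a ≡ z
  ≡z a∈ = [ ⊥-elim ∘ x∈p─q⇒x∉q e (M H) a∈ , x∈⁅y⁆⇒x≡y z ]′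
            (x∈p∪q⁻ (M H) ⁅ z ⁆ (e⊆ (p─q⊆p _ _ a∈)))
... | inj₂ (a , b , a∈F , b∈F , a≢b) =
  step (λ ≤1 → a≢b (≤1 a b a∈F b∈F)) z z∈F λ y y∈F y≢z →
    markedEdge⇒makerWin _ (e , edge-mark-delete H e∈E e⊆ y∈F y≢z)

IsMatching : ∀ {n} → Graph n → Set
IsMatching G = ∀ {x u w} → Adj G x u → Adj G x w → u ≡ w

module _ {n} (G : Graph n) where

  allFree : ∀ i → i ∈ Free (toMHG G)
  allFree i = x∈p∧x∉q⇒x∈p─q ∈⊤ ∉⊥

  cherry⇒makerWin : ∀ {x u w} → Adj G x u → Adj G x w → u ≢ w → MakerWin (toMHG G)
  cherry⇒makerWin {x} {u} {w} x~u x~w u≢w =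
    step (λ ≤1 → irrefl G (subst (Adj G x) (≡.sym (≤1 x u (allFree x) (allFree u))) x~u))
         x (allFree x) reply
    where
    edgeSurvives : ∀ {v y} → Adj G x v → y ≢ x → y ≢ v →
                   MakerWin (delete (mark (toMHG G) x) y)
    edgeSurvives {v} {y} x~v y≢x y≢v =
      nearlyMarkedEdge⇒makerWin _
        (Free-mark-delete⁺ (toMHG G) (allFree v) (λ { refl → irrefl G x~v }) (y≢v ∘ ≡.sym))
        ((x , v , x~v , refl) , [ y≢x , y≢v ]′ ∘ x∈⁅y⁆∪⁅z⁆⁻)
        λ i∈e → [ (λ { refl → p⊆p∪q ⁅ v ⁆ (x∈M-mark-delete (toMHG G) y≢x) }) ,
                  (λ { refl → x∈p∪q⁺ (inj₂ (x∈⁅x⁆ v)) }) ]′ (x∈⁅y⁆∪⁅z⁆⁻ i∈e)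
    reply : ∀ y → y ∈ Free (toMHG G) → y ≢ x → MakerWin (delete (mark (toMHG G) x) y)
    reply y _ y≢x with y ≟ u
    ... | yes refl = edgeSurvives x~w y≢x u≢w
    ... | no y≢u = edgeSurvives x~u y≢x y≢u

  breakerWin⇒matching : BreakerWin (toMHG G) → IsMatching G
  breakerWin⇒matching breakerWins {u = u} {w} x~u x~w with u ≟ w
  ... | yes u≡w = u≡w
  ... | no u≢w = ⊥-elim (breakerWins (cherry⇒makerWin x~u x~w u≢w))

  FreeEdges : MHG n → Set
  FreeEdges H = ∀ e → E H e →
    ∃₂ λ i j → Adj G i j × e ≡ ⁅ i ⁆ ∪ ⁅ j ⁆ × i ∈ Free H × j ∈ Free H

  freeEdges⇒¬trivialMakerWin : ∀ {H} → FreeEdges H → ¬ TrivialMakerWin H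
  freeEdges⇒¬trivialMakerWin {H} free (e , e∈E , ≤1) with free e e∈E
  ... | i , j , i~j , refl , i∈F , j∈F =
    irrefl G (subst (Adj G i) (≡.sym i≡j) i~j)
    where
    freeEnd : ∀ {k} → k ∈ ⁅ i ⁆ ∪ ⁅ j ⁆ → k ∈ Free H → k ∈ (⁅ i ⁆ ∪ ⁅ j ⁆) ─ M H
    freeEnd k∈e k∈F = x∈p∧x∉q⇒x∈p─q k∈e (free⇒unmarked H k∈F)
    i≡j : i ≡ j
    i≡j = ≤1 i j (freeEnd (x∈⁅x⁆∪⁅y⁆ i j) i∈F) (freeEnd (y∈⁅x⁆∪⁅y⁆ i j) j∈F)

  freeEdges-mark-delete : ∀ H {x y} → (∀ j → Adj G x j → j ∈ Free H → j ≡ y) →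
                          FreeEdges H → FreeEdges (delete (mark H x) y)
  freeEdges-mark-delete H {x} {y} partner free e (e∈E , y∉e) with free e e∈E
  ... | i , j , i~j , refl , i∈F , j∈F =
    i , j , i~j , refl ,
    Free-mark-delete⁺ H i∈F i≢x (λ { refl → y∉e (x∈⁅x⁆∪⁅y⁆ i j) }) ,
    Free-mark-delete⁺ H j∈F j≢x (λ { refl → y∉e (y∈⁅x⁆∪⁅y⁆ i j) })
    where
    i≢x : i ≢ x
    i≢x refl = y∉e (subst (_∈ ⁅ i ⁆ ∪ ⁅ j ⁆) (partner j i~j j∈F) (y∈⁅x⁆∪⁅y⁆ i j))
    j≢x : j ≢ x
    j≢x refl = y∉e (subst (_∈ ⁅ i ⁆ ∪ ⁅ j ⁆) (partner i (sym G i~j) i∈F) (x∈⁅x⁆∪⁅y⁆ i j))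

  breakerReply : IsMatching G → ∀ H → ¬ AtMostOne (Free H) → ∀ x →
                 ∃ λ y → y ∈ Free H × y ≢ x × (∀ j → Adj G x j → j ∈ Free H → j ≡ y)
  breakerReply matching H ¬≤1 x with any? (λ j → adj? G x j ×-dec (j ∈? Free H))
  ... | yes (y , x~y , y∈F) = y , y∈F , (λ { refl → irrefl G x~y }) , λ j x~j _ → matching x~j x~y
  ... | no ∄j with ¬atMostOne⇒∃≢ (Free H) ¬≤1 x
  ...   | y , y∈F , y≢x = y , y∈F , y≢x , λ j x~j j∈F → ⊥-elim (∄j (j , x~j , j∈F))

  freeEdges⇒breakerWin : IsMatching G → ∀ H → FreeEdges H → BreakerWin H
  freeEdges⇒breakerWin matching H free (base _ trivial) = freeEdges⇒¬trivialMakerWin free trivial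
  freeEdges⇒breakerWin matching H free (step ¬≤1 x _ makerWins) with breakerReply matching H ¬≤1 x
  ... | y , y∈F , y≢x , partner =
    freeEdges⇒breakerWin matching _ (freeEdges-mark-delete H partner free) (makerWins y y∈F y≢x)

  breakerWin⇔matching : BreakerWin (toMHG G) ⇔ IsMatching G
  breakerWin⇔matching = mk⇔ breakerWin⇒matching λ matching →
    freeEdges⇒breakerWin matching (toMHG G)
      λ e (i , j , i~j , e≡) → i , j , i~j , e≡ , allFree i , allFree j

imageVia-⊤ : ∀ {n m} (W : Subset m) (g : Fin m → Fin n) → imageVia W g ⊤ ≡ W
imageVia-⊤ W g = begin
  tabulate (λ j → lookup W j ∧ lookup ⊤ (g j)) ≡⟨ tabulate-cong ∧true ⟩
  tabulate (lookup W)                          ≡⟨ tabulate∘lookup W ⟩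
  W                                            ∎
  where
  open ≡.≡-Reasoning
  ∧true : ∀ j → lookup W j ∧ lookup ⊤ (g j) ≡ lookup W j
  ∧true j = trans (cong (lookup W j ∧_) (lookup-replicate (g j) true)) (∧-identityʳ _)

module _ {n} (G : Graph n) where

  edgeAt : Fin n → Fin n → MHG n
  edgeAt x u = record { V = ⁅ x ⁆ ∪ ⁅ u ⁆ ; E = _≡ ⁅ x ⁆ ∪ ⁅ u ⁆ ; M = ⊥ }

  edgeAt-iso : ∀ {x u} → u ≢ x → Iso (edgeAt x u ,ₚ x) trivialDanger2
  edgeAt-iso {x} {u} u≢x = record
    { f = f
    ; g = g
    ; f-V = λ _ _ → ∈⊤
    ; g-V = λ { zero _ → x∈⁅x⁆∪⁅y⁆ x u ; (suc _) _ → y∈⁅x⁆∪⁅y⁆ x u }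
    ; gf = gf
    ; fg = λ { zero _ → fx≡0 ; (suc zero) _ → fu≡1 }
    ; f-E = λ { _ refl → cong₂ _∷_ ([]=⇒lookup (x∈⁅x⁆∪⁅y⁆ x u))
                                (cong₂ _∷_ ([]=⇒lookup (y∈⁅x⁆∪⁅y⁆ x u)) refl) }
    ; g-E = λ { _ refl → imageVia-⊤ (⁅ x ⁆ ∪ ⁅ u ⁆) f }
    ; f-M = λ _ _ → mk⇔ (⊥-elim ∘ ∉⊥) (⊥-elim ∘ ∉⊥)
    ; f-pt = fx≡0
    }
    where
    f : Fin n → Fin 2
    f i with i ≟ x
    ... | yes _ = zero
    ... | no _ = suc zero
    g : Fin 2 → Fin n
    g zero = x
    g (suc _) = u
    fx≡0 : f x ≡ zero
    fx≡0 with x ≟ x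
    ... | yes _ = refl
    ... | no x≢x = ⊥-elim (x≢x refl)
    fu≡1 : f u ≡ suc zero
    fu≡1 with u ≟ x
    ... | yes u≡x = ⊥-elim (u≢x u≡x)
    ... | no _ = refl
    gf : ∀ i → i ∈ ⁅ x ⁆ ∪ ⁅ u ⁆ → g (f i) ≡ i
    gf i i∈ with i ≟ x | x∈⁅y⁆∪⁅z⁆⁻ i∈
    ... | yes i≡x | _ = ≡.sym i≡x
    ... | no i≢x | inj₁ i≡x = ⊥-elim (i≢x i≡x)
    ... | no _ | inj₂ i≡u = ≡.sym i≡u

  edgeAt∈x𝓕₂ : ∀ {x u} → Adj G x u → (x · 𝓕₂ ⟨ toMHG G ⟩) (edgeAt x u)
  edgeAt∈x𝓕₂ {x} {u} x~u = isSub , x∈⁅x⁆∪⁅y⁆ x u , tt ,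
                           edgeAt-iso (λ { refl → irrefl G x~u })
    where
    isSub : IsSub (edgeAt x u) (toMHG G)
    isSub = record
      { isMHG = record
        { V-nonempty = x , x∈⁅x⁆∪⁅y⁆ x u
        ; edge-nonempty = λ { _ refl → x , x∈⁅x⁆∪⁅y⁆ x u }
        ; edge-⊆V = λ { _ refl i∈e → i∈e }
        ; M-⊆V = ⊥-elim ∘ ∉⊥ }
      ; V⊆ = λ _ → ∈⊤
      ; E⊆ = λ _ e≡ → x , u , x~u , e≡
      ; M≡ = ≡.sym (∩-zeroʳ _) }

  -- The isomorphism carries the edge ⊤ of the trivial danger to the edge V(X) of X.
  x𝓕₂⇒neighbour : ∀ {x X} → (x · 𝓕₂ ⟨ toMHG G ⟩) X → ∃ λ u → Adj G x u × u ∈ V X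
  x𝓕₂⇒neighbour {x} {X} (isSub , x∈X , _ , iso)
    with IsSub.E⊆ isSub (V X) (subst (E X) (imageVia-⊤ (V X) (Iso.f iso)) (Iso.g-E iso ⊤ refl))
  ... | i , j , i~j , X≡ with x∈⁅y⁆∪⁅z⁆⁻ (subst (x ∈_) X≡ x∈X)
  ...   | inj₁ refl = j , i~j , subst (j ∈_) (≡.sym X≡) (y∈⁅x⁆∪⁅y⁆ i j)
  ...   | inj₂ refl = i , sym G i~j , subst (i ∈_) (≡.sym X≡) (x∈⁅x⁆∪⁅y⁆ i j)

  unmarked-mark : ∀ {v x} → v ≢ x → v ∉ M (mark (toMHG G) x)
  unmarked-mark v≢x v∈M = [ ∉⊥ , v≢x ∘ x∈⁅y⁆⇒x≡y _ ]′ (x∈p∪q⁻ ⊥ _ v∈M)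

  matching⇒J₁ : 2 ≤ n → IsMatching G → J₁ 𝓕₂ (toMHG G)
  matching⇒J₁ 2≤n matching x _ _ with any? (adj? G x)
  ... | yes (u , x~u) = u , ∈⊤ , unmarked-mark (λ { refl → irrefl G x~u }) , u∈
    where
    u∈ : ∀ X → (x · 𝓕₂ ⟨ toMHG G ⟩) X → u ∈ V X
    u∈ X X∈ with x𝓕₂⇒neighbour X∈
    ... | u′ , x~u′ , u′∈X = subst (_∈ V X) (matching x~u′ x~u) u′∈X
  ... | no ∄u with ∃≢ 2≤n x
  ...   | v , v≢x = v , ∈⊤ , unmarked-mark v≢x , λ X → ⊥-elim ∘ ∄u ∘ neighbour
    where
    neighbour : ∀ {X} → (x · 𝓕₂ ⟨ toMHG G ⟩) X → ∃ (Adj G x)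
    neighbour X∈ with x𝓕₂⇒neighbour X∈
    ... | u , x~u , _ = u , x~u

  J₁⇒matching : J₁ 𝓕₂ (toMHG G) → IsMatching G
  J₁⇒matching j₁ {x} x~u x~w with j₁ x ∈⊤ ∉⊥
  ... | v , _ , v∉M , v∈all = trans (≡.sym (v≡ x~u)) (v≡ x~w)
    where
    v≡ : ∀ {u} → Adj G x u → v ≡ u
    v≡ {u} x~u with x∈⁅y⁆∪⁅z⁆⁻ (v∈all (edgeAt x u) (edgeAt∈x𝓕₂ x~u))
    ... | inj₁ refl = ⊥-elim (v∉M (x∈p∪q⁺ (inj₂ (x∈⁅x⁆ x))))
    ... | inj₂ v≡u = v≡u

  J₁⇔matching : 2 ≤ n → J₁ 𝓕₂ (toMHG G) ⇔ IsMatching G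
  J₁⇔matching 2≤n = mk⇔ J₁⇒matching (matching⇒J₁ 2≤n)

mainTheorem18 : (n : ℕ) → 2 ≤ n → (G : Graph n) →
    BreakerWin (toMHG G) ⇔ J₁ 𝓕₂ (toMHG G)
mainTheorem18 n 2≤n G = ⇔-sym (J₁⇔matching G 2≤n) ⇔-∘ breakerWin⇔matching G
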